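{- Let $n$ and $k$ be positive integers with $k \le n$, let $\alpha = 3\lceil \log n \rceil$ with $\alpha \le n$, and let $B_1, \dots, B_k$ be bases (not necessarily disjoint) of a matroid $M$ of rank $n$ with rank function $r$. Let $Q(B_1, \dots, B_k)$ be the probability that, when $\alpha$-element subsets $S_1 \subseteq B_1, \dots, S_k \subseteq B_k$ are chosen independently and uniformly at random, $r(S_1 \cup \cdots \cup S_k) < k$. Let $Q_{k,n}$ be the probability that, when $\alpha$-element subsets $S'_1, \dots, S'_k$ of $\{1, \dots, n\}$ are chosen independently and uniformly at random, $|S'_1 \cup \cdots \cup S'_k| < k$. Then $Q(B_1, \dots, B_k) \le Q_{k,n}$.
   Context: $\log$ denotes the natural logarithm. -}

module Defs where

open import Data.Nat as ℕ using (ℕ; zero; suc; _≤_; _<_; _*_)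
open import Data.Bool using (Bool; true; false; _∧_)
open import Data.Fin using (Fin)
open import Data.Fin.Subset using (Subset; inside; outside; _⊆_; _∪_; _∩_; ⊤; ∣_∣; ⁅_⁆; _∈_; _∉_; ⋃)
open import Data.Fin.Subset.Properties using (_⊆?_)
open import Data.Vec using (Vec; []; _∷_; toList)
open import Data.List using (List; [_]; _++_; map; concatMap; filter; length)
open import Data.Integer using (+_)
open import Data.Rational as ℚ using (ℚ; 0ℚ; 1ℚ)
open import Relation.Binary.PropositionalEquality using (_≡_)
open import Relation.Nullary using (¬_; does)
open import Relation.Nullary.Decidable using (⌊_⌋)
open import Data.Product using (_×_; ∃)
open import Data.Sum using (_⊎_)

-- Natural logarithm ceiling, without reals.
-- expTerm c j = c^j / j!,  expPartial c N = Σ_{j=0}^{N} c^j / j!,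
-- which increases to e^c.

expTerm : ℕ → ℕ → ℚ
expTerm c zero    = 1ℚ
expTerm c (suc j) = expTerm c j ℚ.* ((+ c) ℚ./ suc j)

expPartial : ℕ → ℕ → ℚ
expPartial c zero    = 1ℚ
expPartial c (suc N) = expPartial c N ℚ.+ expTerm c (suc N)

-- n ≤ e^c   (⇔ for every ε = 1/(k+1) some partial sum exceeds n - ε)
LeExp : ℕ → ℕ → Set
LeExp n c = ∀ (k : ℕ) → ∃ λ N → ((+ n) ℚ./ 1) ℚ.- ((+ 1) ℚ./ suc k) ℚ.< expPartial c N

-- e^c < n   (⇔ all partial sums stay below n - ε for some ε = 1/(k+1))
ExpLt : ℕ → ℕ → Set
ExpLt c n = ∃ λ k → ∀ (N : ℕ) → expPartial c N ℚ.≤ ((+ n) ℚ./ 1) ℚ.- ((+ 1) ℚ./ suc k)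

-- IsCeilLog n c  :⇔  c = ⌈ log n ⌉ (natural log), i.e. c is the least
-- natural number with n ≤ e^c.
IsCeilLog : ℕ → ℕ → Set
IsCeilLog n zero    = LeExp n zero
IsCeilLog n (suc c) = LeExp n (suc c) × ExpLt c n

record Matroid (m : ℕ) : Set where
  field
    r        : Subset m → ℕ
    r-bound  : ∀ X → r X ≤ ∣ X ∣
    r-mono   : ∀ {X Y} → X ⊆ Y → r X ≤ r Y
    r-submod : ∀ X Y → r (X ∪ Y) ℕ.+ r (X ∩ Y) ≤ r X ℕ.+ r Y

  Independent : Subset m → Set
  Independent X = r X ≡ ∣ X ∣

  rank : ℕ
  rank = r ⊤

  IsBasis : Subset m → Set
  IsBasis B = Independent B × (∀ x → x ∉ B → ¬ Independent (B ∪ ⁅ x ⁆))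

subsets : (m : ℕ) → List (Subset m)
subsets zero    = [ [] ]
subsets (suc m) = map (outside ∷_) (subsets m) ++ map (inside ∷_) (subsets m)

tuples : (m k : ℕ) → List (Vec (Subset m) k)
tuples m zero    = [ [] ]
tuples m (suc k) = concatMap (λ S → map (S ∷_) (tuples m k)) (subsets m)

admissible : ∀ {m k} → ℕ → Vec (Subset m) k → Vec (Subset m) k → Bool
admissible α []       []       = true
admissible α (B ∷ Bs) (S ∷ Ss) = ⌊ S ⊆? B ⌋ ∧ ⌊ ∣ S ∣ ℕ.≟ α ⌋ ∧ admissible α Bs Ss

-- the sample space: all admissible tuples (uniform product distribution)
sample : ∀ {m k} → ℕ → Vec (Subset m) k → List (Vec (Subset m) k)
sample {m} {k} α Bs = filter (λ Ss → admissible α Bs Ss ≡? true) (tuples m k)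
  where
  open import Data.Bool.Properties using () renaming (_≟_ to _≡?_)

-- number of outcomes with r(S₁ ∪ ⋯ ∪ S_k) < k   (numerator of Q(B₁,…,B_k))
badMatroid : ∀ {m} (M : Matroid m) (k α : ℕ) → Vec (Subset m) k → ℕ
badMatroid M k α Bs =
  length (filter (λ Ss → Matroid.r M (⋃ (toList Ss)) ℕ.<? k) (sample α Bs))

-- total number of outcomes (denominator of Q(B₁,…,B_k))
totalMatroid : ∀ {m k} (α : ℕ) → Vec (Subset m) k → ℕ
totalMatroid α Bs = length (sample α Bs)

-- Q_{k,n}: S'_i ranging over α-subsets of {1,…,n} = Fin n
allFull : (n k : ℕ) → Vec (Subset n) k
allFull n zero    = []
allFull n (suc k) = ⊤ ∷ allFull n k

badFree : (n k α : ℕ) → ℕ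
badFree n k α =
  length (filter (λ Ss → ∣ ⋃ (toList Ss) ∣ ℕ.<? k) (sample α (allFull n k)))

totalFree : (n k α : ℕ) → ℕ
totalFree n k α = length (sample α (allFull n k))

-- Reveal S₁, S₂, … one at a time and compare the rank of the union F revealed so far with the
-- size of the union G in the free model on Fin n. If r F ≥ s, the next basis B contains a set X
-- of s elements such that every α-subset S ⊆ B raises the rank to at least s + ∣ S ∖ X ∣: take
-- T ⊆ B independent and spanning over F, so that B ∖ T has exactly r F elements, and choose X
-- inside B ∖ T. In the free model S takes a union G of size s to exactly s + ∣ S ∖ G ∣, and
-- (∣ B ∖ X ∣ , ∣ B ∩ X ∣) = (n ∸ s , s) = (∣ ∁ G ∣ , ∣ G ∣). So, stage by stage, M has at most
-- as many bad outcomes as the free model, while both sample spaces have (n C α) ^ k outcomes.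

module Submission where

open import Defs
open import Data.Bool using (Bool; true; false; _∧_; if_then_else_; T)
open import Data.Bool.Properties using (if-float; if-eta; ∧-assoc; ∧-zeroʳ) renaming (_≟_ to _≟ᵇ_)
open import Data.Empty using (⊥-elim)
open import Data.Fin using (Fin; zero; suc)
open import Data.Fin.Subset
open import Data.Fin.Subset.Properties
open import Data.List using (List; []; _∷_; _++_; map; concatMap; filter; length)
open import Data.List.Properties
  using (filter-++; filter-≐; length-++; length-map; map-++; map-cong; map-∘; concatMap-cong)
open import Data.Nat as ℕ
  using (ℕ; zero; suc; _+_; _*_; _∸_; _^_; _≤_; _<_; _<ᵇ_; z≤n; s≤s; NonZero)
open import Data.Nat.Combinatorics using (_C_; nCk+nC[k+1]≡[n+1]C[k+1])
open import Data.Nat.ListAction using (sum)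
open import Data.Nat.ListAction.Properties using (sum-++)
open import Data.Nat.Properties
open import Algebra.Properties.CommutativeSemigroup +-commutativeSemigroup
  using (interchange; xy∙z≈xz∙y; x∙yz≈y∙xz)
open import Data.Product using (∃; ∃-syntax; _×_; _,_; proj₁; proj₂)
open import Data.Sum using (inj₁; inj₂)
open import Data.Unit using (tt)
open import Data.Vec using (Vec; []; _∷_; toList; lookup; here; there)
open import Function using (_∘_)
open import Level using (Level)
open import Relation.Binary.PropositionalEquality
open import Relation.Nullary using (Dec; yes; no; does; contradiction)
open import Relation.Nullary.Decidable using (isYes≗does)
open import Relation.Unary using (Pred; Decidable)

private
  variable
    A B : Set
    n : ℕ
    ℓ : Level

sum-map-cong : ∀ (xs : List A) {f g : A → ℕ} → (∀ x → f x ≡ g x) → sum (map f xs) ≡ sum (map g xs)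
sum-map-cong xs f≗g = cong sum (map-cong f≗g xs)

sum-map-mono : ∀ (xs : List A) {f g : A → ℕ} → (∀ x → f x ≤ g x) → sum (map f xs) ≤ sum (map g xs)
sum-map-mono []       f≤g = z≤n
sum-map-mono (x ∷ xs) f≤g = +-mono-≤ (f≤g x) (sum-map-mono xs f≤g)

sum-map-zero : ∀ (xs : List A) {f : A → ℕ} → (∀ x → f x ≡ 0) → sum (map f xs) ≡ 0
sum-map-zero []       f≡0 = refl
sum-map-zero (x ∷ xs) f≡0 = cong₂ _+_ (f≡0 x) (sum-map-zero xs f≡0)

length-concatMap : ∀ (g : A → List B) xs → length (concatMap g xs) ≡ sum (map (length ∘ g) xs)
length-concatMap g []       = refl
length-concatMap g (x ∷ xs) = trans (length-++ (g x)) (cong (length (g x) +_) (length-concatMap g xs))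

module _ {P : Pred B ℓ} (P? : Decidable P) where

  filter-map : ∀ (f : A → B) xs → filter P? (map f xs) ≡ map f (filter (P? ∘ f) xs)
  filter-map f []       = refl
  filter-map f (x ∷ xs) with does (P? (f x))
  ... | true  = cong (f x ∷_) (filter-map f xs)
  ... | false = filter-map f xs

  filter-concatMap : ∀ (g : A → List B) xs → filter P? (concatMap g xs) ≡ concatMap (filter P? ∘ g) xs
  filter-concatMap g []       = refl
  filter-concatMap g (x ∷ xs) =
    trans (filter-++ P? (g x) (concatMap g xs)) (cong (filter P? (g x) ++_) (filter-concatMap g xs))

  length-filter-singleton : ∀ x → length (filter P? (x ∷ [])) ≡ (if does (P? x) then 1 else 0)
  length-filter-singleton x with does (P? x)
  ... | true  = refl
  ... | false = refl

length-filter-<-cong : ∀ (xs : List A) k {f g : A → ℕ} → (∀ x → f x ≡ g x) →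
  length (filter (λ x → f x <? k) xs) ≡ length (filter (λ x → g x <? k) xs)
length-filter-<-cong xs k f≗g =
  cong length (filter-≐ _ _ ((λ {x} → subst (_< k) (f≗g x)) , (λ {x} → subst (_< k) (sym (f≗g x)))) xs)

if-<ᵇ-antitone : ∀ k {a b} → a ≤ b → (if b <ᵇ k then 1 else 0) ≤ (if a <ᵇ k then 1 else 0)
if-<ᵇ-antitone k {a} {b} a≤b with b <ᵇ k in b<ᵇk | a <ᵇ k in a<ᵇk
... | true  | true  = ≤-refl
... | true  | false = ⊥-elim (subst T a<ᵇk (<⇒<ᵇ (≤-<-trans a≤b (<ᵇ⇒< b k (subst T (sym b<ᵇk) tt)))))
... | false | _     = z≤n

-- Finite subsets

∪-least : ∀ {p q s : Subset n} → p ⊆ s → q ⊆ s → p ∪ q ⊆ s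
∪-least {p = p} {q} p⊆s q⊆s x∈p∪q with x∈p∪q⁻ p q x∈p∪q
... | inj₁ x∈p = p⊆s x∈p
... | inj₂ x∈q = q⊆s x∈q

∩-greatest : ∀ {p q s : Subset n} → s ⊆ p → s ⊆ q → s ⊆ p ∩ q
∩-greatest s⊆p s⊆q x∈s = x∈p∩q⁺ (s⊆p x∈s , s⊆q x∈s)

p⊆q⇒q∩p≡p : ∀ {p q : Subset n} → p ⊆ q → q ∩ p ≡ p
p⊆q⇒q∩p≡p {p = p} {q} p⊆q = ⊆-antisym (p∩q⊆q q p) (∩-greatest p⊆q ⊆-refl)

x∈p⇒⁅x⁆⊆p : ∀ {x : Fin n} {p : Subset n} → x ∈ p → ⁅ x ⁆ ⊆ p
x∈p⇒⁅x⁆⊆p {p = p} x∈p y∈⁅x⁆ = subst (_∈ p) (sym (x∈⁅y⁆⇒x≡y _ y∈⁅x⁆)) x∈p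

∣p∣≡∣p∩q∣+∣p∩∁q∣ : ∀ (p q : Subset n) → ∣ p ∣ ≡ ∣ p ∩ q ∣ + ∣ p ∩ ∁ q ∣
∣p∣≡∣p∩q∣+∣p∩∁q∣ []            []            = refl
∣p∣≡∣p∩q∣+∣p∩∁q∣ (inside  ∷ p) (inside  ∷ q) = cong suc (∣p∣≡∣p∩q∣+∣p∩∁q∣ p q)
∣p∣≡∣p∩q∣+∣p∩∁q∣ (inside  ∷ p) (outside ∷ q) =
  trans (cong suc (∣p∣≡∣p∩q∣+∣p∩∁q∣ p q)) (sym (+-suc _ _))
∣p∣≡∣p∩q∣+∣p∩∁q∣ (outside ∷ p) (_       ∷ q) = ∣p∣≡∣p∩q∣+∣p∩∁q∣ p q

∣p∪q∣≡∣p∣+∣q∩∁p∣ : ∀ (p q : Subset n) → ∣ p ∪ q ∣ ≡ ∣ p ∣ + ∣ q ∩ ∁ p ∣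
∣p∪q∣≡∣p∣+∣q∩∁p∣ []            []            = refl
∣p∪q∣≡∣p∣+∣q∩∁p∣ (inside  ∷ p) (inside  ∷ q) = cong suc (∣p∪q∣≡∣p∣+∣q∩∁p∣ p q)
∣p∪q∣≡∣p∣+∣q∩∁p∣ (inside  ∷ p) (outside ∷ q) = cong suc (∣p∪q∣≡∣p∣+∣q∩∁p∣ p q)
∣p∪q∣≡∣p∣+∣q∩∁p∣ (outside ∷ p) (inside  ∷ q) =
  trans (cong suc (∣p∪q∣≡∣p∣+∣q∩∁p∣ p q)) (sym (+-suc _ _))
∣p∪q∣≡∣p∣+∣q∩∁p∣ (outside ∷ p) (outside ∷ q) = ∣p∪q∣≡∣p∣+∣q∩∁p∣ p q

x∉p⇒∣p∪⁅x⁆∣≡1+∣p∣ : ∀ {x : Fin n} {p : Subset n} → x ∉ p → ∣ p ∪ ⁅ x ⁆ ∣ ≡ suc ∣ p ∣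
x∉p⇒∣p∪⁅x⁆∣≡1+∣p∣ {x = zero}  {inside  ∷ p} x∉p = contradiction here x∉p
x∉p⇒∣p∪⁅x⁆∣≡1+∣p∣ {x = zero}  {outside ∷ p} x∉p = cong (suc ∘ ∣_∣) (∪-identityʳ p)
x∉p⇒∣p∪⁅x⁆∣≡1+∣p∣ {x = suc x} {inside  ∷ p} x∉p = cong suc (x∉p⇒∣p∪⁅x⁆∣≡1+∣p∣ (x∉p ∘ there))
x∉p⇒∣p∪⁅x⁆∣≡1+∣p∣ {x = suc x} {outside ∷ p} x∉p = x∉p⇒∣p∪⁅x⁆∣≡1+∣p∣ (x∉p ∘ there)

∃-⊆-of-size : ∀ (p : Subset n) {s} → s ≤ ∣ p ∣ → ∃[ q ] q ⊆ p × ∣ q ∣ ≡ s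
∃-⊆-of-size {n} p {zero} _ = ⊥ , ⊆-min p , ∣⊥∣≡0 n
∃-⊆-of-size (inside ∷ p) {suc s} (s≤s s≤∣p∣) with ∃-⊆-of-size p s≤∣p∣
... | q , q⊆p , ∣q∣≡s = inside ∷ q , in⊆in q⊆p , cong suc ∣q∣≡s
∃-⊆-of-size (outside ∷ p) {suc s} s<∣p∣ with ∃-⊆-of-size p s<∣p∣
... | q , q⊆p , ∣q∣≡s = outside ∷ q , s⊆s q⊆p , ∣q∣≡s

fromList : List (Fin n) → Subset n
fromList []       = ⊥
fromList (x ∷ xs) = fromList xs ∪ ⁅ x ⁆

elements : Subset n → List (Fin n)
elements []            = []
elements (inside  ∷ p) = zero ∷ map suc (elements p)
elements (outside ∷ p) = map suc (elements p)

fromList-map-suc : ∀ (xs : List (Fin n)) → fromList (map suc xs) ≡ outside ∷ fromList xs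
fromList-map-suc []       = refl
fromList-map-suc (x ∷ xs) = cong (_∪ ⁅ suc x ⁆) (fromList-map-suc xs)

fromList-elements : ∀ (p : Subset n) → fromList (elements p) ≡ p
fromList-elements []            = refl
fromList-elements (inside  ∷ p) rewrite fromList-map-suc (elements p) =
  cong (inside ∷_) (trans (∪-identityʳ _) (fromList-elements p))
fromList-elements (outside ∷ p) =
  trans (fromList-map-suc (elements p)) (cong (outside ∷_) (fromList-elements p))

-- Weighted counts of α-subsets

-- chooseSum p q a h = Σ_d (p C d) (q C (a ∸ d)) h d: the sum, over the a-subsets of a set split
-- into parts of sizes p and q, of h applied to the number of elements drawn from the first part.
chooseSum : ℕ → ℕ → ℕ → (ℕ → ℕ) → ℕ
chooseSum zero    zero    zero    h = h 0
chooseSum zero    zero    (suc a) h = 0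
chooseSum zero    (suc q) zero    h = chooseSum 0 q 0 h
chooseSum zero    (suc q) (suc a) h = chooseSum 0 q (suc a) h + chooseSum 0 q a h
chooseSum (suc p) q       zero    h = chooseSum p q zero h
chooseSum (suc p) q       (suc a) h = chooseSum p q (suc a) h + chooseSum p q a (h ∘ suc)

chooseSum-suc-zero : ∀ p q h → chooseSum p (suc q) zero h ≡ chooseSum p q zero h
chooseSum-suc-zero zero    q h = refl
chooseSum-suc-zero (suc p) q h = chooseSum-suc-zero p q h

chooseSum-suc-suc : ∀ p q a h →
  chooseSum p (suc q) (suc a) h ≡ chooseSum p q (suc a) h + chooseSum p q a h
chooseSum-suc-suc zero    q a       h = refl
chooseSum-suc-suc (suc p) q zero    h =
  trans (cong₂ _+_ (chooseSum-suc-suc p q 0 h) (chooseSum-suc-zero p q (h ∘ suc)))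
        (xy∙z≈xz∙y (chooseSum p q 1 h) (chooseSum p q 0 h) (chooseSum p q 0 (h ∘ suc)))
chooseSum-suc-suc (suc p) q (suc a) h =
  trans (cong₂ _+_ (chooseSum-suc-suc p q (suc a) h) (chooseSum-suc-suc p q a (h ∘ suc)))
        (interchange (chooseSum p q (2 + a) h) (chooseSum p q (suc a) h)
                     (chooseSum p q (suc a) (h ∘ suc)) (chooseSum p q a (h ∘ suc)))

chooseSum-const : ∀ q a c → chooseSum 0 q a (λ _ → c) ≡ (q C a) * c
chooseSum-const zero    zero    c = sym (+-identityʳ c)
chooseSum-const zero    (suc a) c = refl
chooseSum-const (suc q) zero    c = chooseSum-const q zero c
chooseSum-const (suc q) (suc a) c = begin
  chooseSum 0 q (suc a) (λ _ → c) + chooseSum 0 q a (λ _ → c)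
    ≡⟨ cong₂ _+_ (chooseSum-const q (suc a) c) (chooseSum-const q a c) ⟩
  (q C suc a) * c + (q C a) * c ≡⟨ +-comm ((q C suc a) * c) ((q C a) * c) ⟩
  (q C a) * c + (q C suc a) * c ≡⟨ *-distribʳ-+ c (q C a) (q C suc a) ⟨
  (q C a + q C suc a) * c       ≡⟨ cong (_* c) (nCk+nC[k+1]≡[n+1]C[k+1] q a) ⟩
  (suc q C suc a) * c           ∎
  where open ≡-Reasoning

chosen : ∀ {m} → ℕ → Subset m → Subset m → Bool
chosen α B S = does (S ⊆? B) ∧ does (∣ S ∣ ℕ.≟ α)

∑chosen : ∀ {m} → ℕ → Subset m → (Subset m → ℕ) → ℕ
∑chosen {m} α B f = sum (map (λ S → if chosen α B S then f S else 0) (subsets m))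

module _ {m} (α : ℕ) (B : Subset m) {f g : Subset m → ℕ} where

  ∑chosen-cong : (∀ S → f S ≡ g S) → ∑chosen α B f ≡ ∑chosen α B g
  ∑chosen-cong f≗g =
    sum-map-cong (subsets m) (λ S → cong (λ x → if chosen α B S then x else 0) (f≗g S))

  ∑chosen-mono : (∀ S → S ⊆ B → f S ≤ g S) → ∑chosen α B f ≤ ∑chosen α B g
  ∑chosen-mono f≤g = sum-map-mono (subsets m) pointwise
    where
    pointwise : ∀ S → (if chosen α B S then f S else 0) ≤ (if chosen α B S then g S else 0)
    pointwise S with S ⊆? B
    ... | no _    = z≤n
    ... | yes S⊆B with does (∣ S ∣ ℕ.≟ α)
    ...   | true  = f≤g S S⊆B
    ...   | false = z≤n

sum-map-subsets-suc : ∀ m (f : Subset (suc m) → ℕ) →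
  sum (map f (subsets (suc m)))
  ≡ sum (map (f ∘ (outside ∷_)) (subsets m)) + sum (map (f ∘ (inside ∷_)) (subsets m))
sum-map-subsets-suc m f = begin
  sum (map f (outsides ++ insides))        ≡⟨ cong sum (map-++ f outsides insides) ⟩
  sum (map f outsides ++ map f insides)    ≡⟨ sum-++ (map f outsides) (map f insides) ⟩
  sum (map f outsides) + sum (map f insides)
    ≡⟨ cong₂ (λ l l′ → sum l + sum l′) (map-∘ (subsets m)) (map-∘ (subsets m)) ⟨
  sum (map (f ∘ (outside ∷_)) (subsets m)) + sum (map (f ∘ (inside ∷_)) (subsets m)) ∎
  where
  open ≡-Reasoning
  outsides insides : List (Subset (suc m))
  outsides = map (outside ∷_) (subsets m)
  insides  = map (inside ∷_) (subsets m)

-- Induction on the ground set: an element of Y ∩ ∁ X taken by S raises ∣ S ∩ ∁ X ∣ by one, an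
-- element of Y ∩ X does not; these are the two recursions of chooseSum.
∑chosen≡chooseSum : ∀ m (Y X : Subset m) a (h : ℕ → ℕ) →
  ∑chosen a Y (λ S → h ∣ S ∩ ∁ X ∣) ≡ chooseSum ∣ Y ∩ ∁ X ∣ ∣ Y ∩ X ∣ a h
∑chosen≡chooseSum zero    []      []      zero    h = +-identityʳ (h 0)
∑chosen≡chooseSum zero    []      []      (suc a) h = refl
∑chosen≡chooseSum (suc m) (y ∷ Y) (x ∷ X) a       h = trans (sum-map-subsets-suc m _) (by-side y x a)
  where
  IH : ∀ a (h : ℕ → ℕ) → ∑chosen a Y (λ S → h ∣ S ∩ ∁ X ∣) ≡ chooseSum ∣ Y ∩ ∁ X ∣ ∣ Y ∩ X ∣ a h
  IH = ∑chosen≡chooseSum m Y X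

  sum-∧-false : ∀ (g : Subset m → ℕ) →
    sum (map (λ S → if does (S ⊆? Y) ∧ false then g S else 0) (subsets m)) ≡ 0
  sum-∧-false g =
    sum-map-zero (subsets m) (λ S → cong (λ b → if b then g S else 0) (∧-zeroʳ (does (S ⊆? Y))))

  by-side : ∀ y x a →
    sum (map (λ S → if chosen a (y ∷ Y) (outside ∷ S) then h ∣ (outside ∷ S) ∩ ∁ (x ∷ X) ∣ else 0)
             (subsets m))
    + sum (map (λ S → if chosen a (y ∷ Y) (inside ∷ S) then h ∣ (inside ∷ S) ∩ ∁ (x ∷ X) ∣ else 0)
               (subsets m))
    ≡ chooseSum ∣ (y ∷ Y) ∩ ∁ (x ∷ X) ∣ ∣ (y ∷ Y) ∩ (x ∷ X) ∣ a h
  by-side outside x       a       =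
    trans (cong₂ _+_ (IH a h) (sum-map-zero (subsets m) (λ _ → refl))) (+-identityʳ _)
  by-side inside  outside zero    = trans (cong₂ _+_ (IH 0 h) (sum-∧-false _)) (+-identityʳ _)
  by-side inside  inside  zero    =
    trans (cong₂ _+_ (IH 0 h) (sum-∧-false _))
          (trans (+-identityʳ _) (sym (chooseSum-suc-zero ∣ Y ∩ ∁ X ∣ ∣ Y ∩ X ∣ h)))
  by-side inside  outside (suc a) = cong₂ _+_ (IH (suc a) h) (IH a (h ∘ suc))
  by-side inside  inside  (suc a) =
    trans (cong₂ _+_ (IH (suc a) h) (IH a h)) (sym (chooseSum-suc-suc ∣ Y ∩ ∁ X ∣ ∣ Y ∩ X ∣ a h))

module _ {m k} (α : ℕ) (B : Subset m) (Bs : Vec (Subset m) k) where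

  admissible-∷ : ∀ S Ss → admissible α (B ∷ Bs) (S ∷ Ss) ≡ chosen α B S ∧ admissible α Bs Ss
  admissible-∷ S Ss =
    trans (cong₂ (λ b c → b ∧ c ∧ admissible α Bs Ss) (isYes≗does (S ⊆? B)) (isYes≗does (∣ S ∣ ℕ.≟ α)))
          (sym (∧-assoc (does (S ⊆? B)) _ _))

  filter-admissible-∷ : ∀ S ts →
    filter (λ Ss → admissible α (B ∷ Bs) Ss ≟ᵇ true) (map (S ∷_) ts)
    ≡ (if chosen α B S then map (S ∷_) (filter (λ Ss → admissible α Bs Ss ≟ᵇ true) ts) else [])
  filter-admissible-∷ S []       = sym (if-eta (chosen α B S))
  filter-admissible-∷ S (t ∷ ts) rewrite admissible-∷ S t with chosen α B S | filter-admissible-∷ S ts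
  ... | false | ih = ih
  ... | true  | ih with admissible α Bs t
  ...   | true  = cong ((S ∷ t) ∷_) ih
  ...   | false = ih

  extend : Subset m → List (Vec (Subset m) (suc k))
  extend S = if chosen α B S then map (S ∷_) (sample α Bs) else []

  sample-∷ : sample α (B ∷ Bs) ≡ concatMap extend (subsets m)
  sample-∷ = trans (filter-concatMap _ (λ S → map (S ∷_) (tuples m k)) (subsets m))
                   (concatMap-cong (λ S → filter-admissible-∷ S (tuples m k)) (subsets m))

  length-sample-∷ : length (sample α (B ∷ Bs)) ≡ ∑chosen α B (λ _ → length (sample α Bs))
  length-sample-∷ = begin
    length (sample α (B ∷ Bs))               ≡⟨ cong length sample-∷ ⟩
    length (concatMap extend (subsets m))    ≡⟨ length-concatMap extend (subsets m) ⟩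
    sum (map (length ∘ extend) (subsets m))  ≡⟨ sum-map-cong (subsets m) length-extend ⟩
    ∑chosen α B (λ _ → length (sample α Bs)) ∎
    where
    open ≡-Reasoning
    length-extend : ∀ S → length (extend S) ≡ (if chosen α B S then length (sample α Bs) else 0)
    length-extend S = trans (if-float length (chosen α B S))
      (cong (λ l → if chosen α B S then l else 0) (length-map (S ∷_) (sample α Bs)))

  length-filter-sample-∷ : ∀ {P : Pred (Vec (Subset m) (suc k)) ℓ} (P? : Decidable P) →
    length (filter P? (sample α (B ∷ Bs))) ≡ ∑chosen α B (λ S → length (filter (P? ∘ (S ∷_)) (sample α Bs)))
  length-filter-sample-∷ P? = begin
    length (filter P? (sample α (B ∷ Bs)))              ≡⟨ cong (length ∘ filter P?) sample-∷ ⟩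
    length (filter P? (concatMap extend (subsets m)))   ≡⟨ cong length (filter-concatMap P? extend (subsets m)) ⟩
    length (concatMap (filter P? ∘ extend) (subsets m)) ≡⟨ length-concatMap (filter P? ∘ extend) (subsets m) ⟩
    sum (map (length ∘ filter P? ∘ extend) (subsets m)) ≡⟨ sum-map-cong (subsets m) count-extend ⟩
    ∑chosen α B (λ S → length (filter (P? ∘ (S ∷_)) (sample α Bs))) ∎
    where
    open ≡-Reasoning
    count-extend : ∀ S → length (filter P? (extend S))
                         ≡ (if chosen α B S then length (filter (P? ∘ (S ∷_)) (sample α Bs)) else 0)
    count-extend S = trans (if-float (length ∘ filter P?) (chosen α B S))
      (cong (λ l → if chosen α B S then l else 0)
            (trans (cong length (filter-map P? (S ∷_) (sample α Bs)))
                   (length-map (S ∷_) (filter (P? ∘ (S ∷_)) (sample α Bs)))))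

length-sample : ∀ {m k} α N (Bs : Vec (Subset m) k) → (∀ i → ∣ lookup Bs i ∣ ≡ N) →
  length (sample α Bs) ≡ (N C α) ^ k
length-sample             α N []       _      = refl
length-sample {m} {suc k} α N (B ∷ Bs) ∣Bs∣≡N = begin
  length (sample α (B ∷ Bs))               ≡⟨ length-sample-∷ α B Bs ⟩
  ∑chosen α B (λ _ → length (sample α Bs)) ≡⟨ cong (λ c → ∑chosen α B (λ _ → c)) IH ⟩
  ∑chosen α B (λ _ → (N C α) ^ k)          ≡⟨ ∑chosen≡chooseSum m B B α (λ _ → (N C α) ^ k) ⟩
  chooseSum ∣ B ∩ ∁ B ∣ ∣ B ∩ B ∣ α (λ _ → (N C α) ^ k)
    ≡⟨ cong₂ (λ p q → chooseSum p q α (λ _ → (N C α) ^ k)) ∣B∩∁B∣≡0 ∣B∩B∣≡N ⟩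
  chooseSum 0 N α (λ _ → (N C α) ^ k)      ≡⟨ chooseSum-const N α ((N C α) ^ k) ⟩
  (N C α) * (N C α) ^ k                     ∎
  where
  open ≡-Reasoning
  IH : length (sample α Bs) ≡ (N C α) ^ k
  IH = length-sample α N Bs (∣Bs∣≡N ∘ suc)
  ∣B∩∁B∣≡0 : ∣ B ∩ ∁ B ∣ ≡ 0
  ∣B∩∁B∣≡0 = trans (cong ∣_∣ (∩-inverseʳ B)) (∣⊥∣≡0 m)
  ∣B∩B∣≡N : ∣ B ∩ B ∣ ≡ N
  ∣B∩B∣≡N = trans (cong ∣_∣ (∩-idem B)) (∣Bs∣≡N zero)

-- The free model

badFreeFrom : ∀ n k α j → Subset n → ℕ
badFreeFrom n k α j G = length (filter (λ Ss → ∣ G ∪ ⋃ (toList Ss) ∣ <? k) (sample α (allFull n j)))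

freeCount : ℕ → ℕ → ℕ → ℕ → ℕ → ℕ
freeCount n k α s zero    = if s <ᵇ k then 1 else 0
freeCount n k α s (suc j) = chooseSum (n ∸ s) s α (λ d → freeCount n k α (s + d) j)

badFreeFrom≡freeCount : ∀ n k α j (G : Subset n) → badFreeFrom n k α j G ≡ freeCount n k α ∣ G ∣ j
badFreeFrom≡freeCount n k α zero    G =
  trans (length-filter-singleton (λ Ss → ∣ G ∪ ⋃ (toList Ss) ∣ <? k) [])
        (cong (λ A → if ∣ A ∣ <ᵇ k then 1 else 0) (∪-identityʳ G))
badFreeFrom≡freeCount n k α (suc j) G = begin
  badFreeFrom n k α (suc j) G
    ≡⟨ length-filter-sample-∷ α ⊤ (allFull n j) (λ Ss → ∣ G ∪ ⋃ (toList Ss) ∣ <? k) ⟩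
  ∑chosen α ⊤ (λ S → length (filter (λ Ss → ∣ G ∪ (S ∪ ⋃ (toList Ss)) ∣ <? k) (sample α (allFull n j))))
    ≡⟨ ∑chosen-cong α ⊤ (λ S → length-filter-<-cong (sample α (allFull n j)) k
                                 (λ Ss → cong ∣_∣ (∪-assoc G S (⋃ (toList Ss))))) ⟨
  ∑chosen α ⊤ (λ S → badFreeFrom n k α j (G ∪ S))
    ≡⟨ ∑chosen-cong α ⊤ (λ S → trans (badFreeFrom≡freeCount n k α j (G ∪ S))
                                     (cong (λ s → freeCount n k α s j) (∣p∪q∣≡∣p∣+∣q∩∁p∣ G S))) ⟩
  ∑chosen α ⊤ (λ S → freeCount n k α (∣ G ∣ + ∣ S ∩ ∁ G ∣) j)
    ≡⟨ ∑chosen≡chooseSum n ⊤ G α (λ d → freeCount n k α (∣ G ∣ + d) j) ⟩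
  chooseSum (∣ ⊤ ∩ ∁ G ∣) (∣ ⊤ ∩ G ∣) α (λ d → freeCount n k α (∣ G ∣ + d) j)
    ≡⟨ cong₂ (λ p q → chooseSum p q α (λ d → freeCount n k α (∣ G ∣ + d) j))
             (trans (cong ∣_∣ (∩-identityˡ (∁ G))) (∣∁p∣≡n∸∣p∣ G)) (cong ∣_∣ (∩-identityˡ G)) ⟩
  freeCount n k α (∣ G ∣) (suc j) ∎
  where open ≡-Reasoning

badFree≡freeCount : ∀ n k α → badFree n k α ≡ freeCount n k α 0 k
badFree≡freeCount n k α = begin
  badFree n k α
    ≡⟨ length-filter-<-cong (sample α (allFull n k)) k (λ Ss → cong ∣_∣ (∪-identityˡ (⋃ (toList Ss)))) ⟨
  badFreeFrom n k α k ⊥         ≡⟨ badFreeFrom≡freeCount n k α k ⊥ ⟩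
  freeCount n k α ∣ ⊥ {n} ∣ k   ≡⟨ cong (λ s → freeCount n k α s k) (∣⊥∣≡0 n) ⟩
  freeCount n k α 0 k           ∎
  where open ≡-Reasoning

-- Matroids

module _ {m} (M : Matroid m) where
  open Matroid M

  r[A∪C]≤r[A]+∣C∣ : ∀ A C → r (A ∪ C) ≤ r A + ∣ C ∣
  r[A∪C]≤r[A]+∣C∣ A C = begin
    r (A ∪ C)             ≤⟨ m≤m+n (r (A ∪ C)) (r (A ∩ C)) ⟩
    r (A ∪ C) + r (A ∩ C) ≤⟨ r-submod A C ⟩
    r A + r C             ≤⟨ +-monoʳ-≤ (r A) (r-bound C) ⟩
    r A + ∣ C ∣           ∎
    where open ≤-Reasoning

  r-∪-span : ∀ {A A′} Z → A ⊆ A′ → r A′ ≤ r A → r (A′ ∪ Z) ≤ r (A ∪ Z)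
  r-∪-span {A} {A′} Z A⊆A′ rA′≤rA = +-cancelʳ-≤ (r A) (r (A′ ∪ Z)) (r (A ∪ Z)) (begin
    r (A′ ∪ Z) + r A                    ≤⟨ +-mono-≤ (r-mono A′∪Z⊆) (r-mono A⊆) ⟩
    r (A′ ∪ (A ∪ Z)) + r (A′ ∩ (A ∪ Z)) ≤⟨ r-submod A′ (A ∪ Z) ⟩
    r A′ + r (A ∪ Z)                    ≤⟨ +-monoˡ-≤ (r (A ∪ Z)) rA′≤rA ⟩
    r A + r (A ∪ Z)                     ≡⟨ +-comm (r A) (r (A ∪ Z)) ⟩
    r (A ∪ Z) + r A                     ∎)
    where
    open ≤-Reasoning
    A′∪Z⊆ : A′ ∪ Z ⊆ A′ ∪ (A ∪ Z)
    A′∪Z⊆ = ∪-least (p⊆p∪q (A ∪ Z)) (⊆-trans (q⊆p∪q A Z) (q⊆p∪q A′ (A ∪ Z)))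
    A⊆ : A ⊆ A′ ∩ (A ∪ Z)
    A⊆ = ∩-greatest A⊆A′ (p⊆p∪q Z)

  r-∪-fromList : ∀ A → (∀ y → r (A ∪ ⁅ y ⁆) ≤ r A) → ∀ ys → r (A ∪ fromList ys) ≤ r A
  r-∪-fromList A closed []       = ≤-reflexive (cong r (∪-identityʳ A))
  r-∪-fromList A closed (y ∷ ys) = begin
    r (A ∪ (fromList ys ∪ ⁅ y ⁆)) ≡⟨ cong r (∪-assoc A (fromList ys) ⁅ y ⁆) ⟨
    r ((A ∪ fromList ys) ∪ ⁅ y ⁆) ≤⟨ r-∪-span ⁅ y ⁆ (p⊆p∪q (fromList ys)) (r-∪-fromList A closed ys) ⟩
    r (A ∪ ⁅ y ⁆)                 ≤⟨ closed y ⟩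
    r A                           ∎
    where open ≤-Reasoning

  r-independent-⊆ : ∀ F {T T′} → T′ ⊆ T → r F + ∣ T ∣ ≤ r (F ∪ T) → r F + ∣ T′ ∣ ≤ r (F ∪ T′)
  r-independent-⊆ F {T} {T′} T′⊆T indep = +-cancelʳ-≤ ∣ T ∩ ∁ T′ ∣ (r F + ∣ T′ ∣) (r (F ∪ T′)) (begin
    r F + ∣ T′ ∣ + ∣ T ∩ ∁ T′ ∣       ≡⟨ +-assoc (r F) ∣ T′ ∣ ∣ T ∩ ∁ T′ ∣ ⟩
    r F + (∣ T′ ∣ + ∣ T ∩ ∁ T′ ∣)     ≡⟨ cong (λ p → r F + (∣ p ∣ + ∣ T ∩ ∁ T′ ∣)) (p⊆q⇒q∩p≡p T′⊆T) ⟨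
    r F + (∣ T ∩ T′ ∣ + ∣ T ∩ ∁ T′ ∣) ≡⟨ cong (r F +_) (∣p∣≡∣p∩q∣+∣p∩∁q∣ T T′) ⟨
    r F + ∣ T ∣                       ≤⟨ indep ⟩
    r (F ∪ T)                         ≤⟨ r-mono F∪T⊆ ⟩
    r ((F ∪ T′) ∪ (T ∩ ∁ T′))         ≤⟨ r[A∪C]≤r[A]+∣C∣ (F ∪ T′) (T ∩ ∁ T′) ⟩
    r (F ∪ T′) + ∣ T ∩ ∁ T′ ∣         ∎)
    where
    open ≤-Reasoning
    F∪T⊆ : F ∪ T ⊆ (F ∪ T′) ∪ (T ∩ ∁ T′)
    F∪T⊆ {x} x∈F∪T with x∈p∪q⁻ F T x∈F∪T | x ∈? T′
    ... | inj₁ x∈F | _        = p⊆p∪q (T ∩ ∁ T′) (p⊆p∪q T′ x∈F)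
    ... | inj₂ x∈T | yes x∈T′ = p⊆p∪q (T ∩ ∁ T′) (q⊆p∪q F T′ x∈T′)
    ... | inj₂ x∈T | no  x∉T′ = q⊆p∪q (F ∪ T′) (T ∩ ∁ T′) (x∈p∩q⁺ (x∈T , x∉p⇒x∈∁p x∉T′))

  -- T is a basis of Y in the contraction M / F.
  BasisOver : Subset m → Subset m → Subset m → Set
  BasisOver F Y T = T ⊆ Y × r F + ∣ T ∣ ≤ r (F ∪ T) × r (F ∪ Y) ≤ r (F ∪ T)

  -- Greedily keep the elements of ys that raise the rank over F ∪ T.
  ∃-basisOver : ∀ F ys → ∃ (BasisOver F (fromList ys))
  ∃-basisOver F [] = ⊥ , ⊆-refl , ≤-reflexive rF+∣⊥∣≡r[F∪⊥] , ≤-refl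
    where
    rF+∣⊥∣≡r[F∪⊥] : r F + ∣ ⊥ {m} ∣ ≡ r (F ∪ ⊥)
    rF+∣⊥∣≡r[F∪⊥] = trans (cong (r F +_) (∣⊥∣≡0 m)) (trans (+-identityʳ (r F)) (cong r (sym (∪-identityʳ F))))
  ∃-basisOver F (y ∷ ys) with ∃-basisOver F ys
  ... | T , T⊆ys , indep , span = extend-by-y (r ((F ∪ T) ∪ ⁅ y ⁆) ≤? r (F ∪ T))
    where
    span-y : r (F ∪ fromList (y ∷ ys)) ≤ r ((F ∪ T) ∪ ⁅ y ⁆)
    span-y = begin
      r (F ∪ (fromList ys ∪ ⁅ y ⁆)) ≡⟨ cong r (∪-assoc F (fromList ys) ⁅ y ⁆) ⟨
      r ((F ∪ fromList ys) ∪ ⁅ y ⁆)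
        ≤⟨ r-∪-span ⁅ y ⁆ (∪-least (p⊆p∪q (fromList ys)) (⊆-trans T⊆ys (q⊆p∪q F (fromList ys)))) span ⟩
      r ((F ∪ T) ∪ ⁅ y ⁆)           ∎
      where open ≤-Reasoning

    extend-by-y : Dec (r ((F ∪ T) ∪ ⁅ y ⁆) ≤ r (F ∪ T)) → ∃ (BasisOver F (fromList (y ∷ ys)))
    extend-by-y (yes y-dependent)   = T , ⊆-trans T⊆ys (p⊆p∪q ⁅ y ⁆) , indep , ≤-trans span-y y-dependent
    extend-by-y (no  y-independent) =
      T ∪ ⁅ y ⁆ , ∪-least (⊆-trans T⊆ys (p⊆p∪q ⁅ y ⁆)) (q⊆p∪q (fromList ys) ⁅ y ⁆) , indep-y ,
      ≤-trans span-y (≤-reflexive (cong r (∪-assoc F T ⁅ y ⁆)))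
      where
      y∉T : y ∉ T
      y∉T y∈T = y-independent (r-mono (∪-least ⊆-refl (x∈p⇒⁅x⁆⊆p (q⊆p∪q F T y∈T))))
      indep-y : r F + ∣ T ∪ ⁅ y ⁆ ∣ ≤ r (F ∪ (T ∪ ⁅ y ⁆))
      indep-y = begin
        r F + ∣ T ∪ ⁅ y ⁆ ∣ ≡⟨ cong (r F +_) (x∉p⇒∣p∪⁅x⁆∣≡1+∣p∣ y∉T) ⟩
        r F + suc ∣ T ∣     ≡⟨ +-suc (r F) ∣ T ∣ ⟩
        suc (r F + ∣ T ∣)   ≤⟨ s≤s indep ⟩
        suc (r (F ∪ T))     ≤⟨ ≰⇒> y-independent ⟩
        r ((F ∪ T) ∪ ⁅ y ⁆) ≡⟨ cong r (∪-assoc F T ⁅ y ⁆) ⟩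
        r (F ∪ (T ∪ ⁅ y ⁆)) ∎
        where open ≤-Reasoning

  module _ {B} (B-basis : IsBasis B) where

    basis-closed : ∀ y → r (B ∪ ⁅ y ⁆) ≤ r B
    basis-closed y with y ∈? B
    ... | yes y∈B = r-mono (∪-least ⊆-refl (x∈p⇒⁅x⁆⊆p y∈B))
    ... | no  y∉B = m<1+n⇒m≤n (≤∧≢⇒< r≤1+rB r≢1+rB)
      where
      r≤1+rB : r (B ∪ ⁅ y ⁆) ≤ suc (r B)
      r≤1+rB = ≤-trans (r[A∪C]≤r[A]+∣C∣ B ⁅ y ⁆)
                       (≤-reflexive (trans (cong (r B +_) (∣⁅x⁆∣≡1 y)) (+-comm (r B) 1)))
      r≢1+rB : r (B ∪ ⁅ y ⁆) ≢ suc (r B)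
      r≢1+rB eq = proj₂ B-basis y y∉B
        (trans eq (trans (cong suc (proj₁ B-basis)) (sym (x∉p⇒∣p∪⁅x⁆∣≡1+∣p∣ y∉B))))

    basis-rank : r B ≡ rank
    basis-rank = ≤-antisym (r-mono (⊆-max B)) (begin
      r ⊤                           ≤⟨ r-mono (q⊆p∪q B ⊤) ⟩
      r (B ∪ ⊤)                     ≡⟨ cong (λ p → r (B ∪ p)) (fromList-elements ⊤) ⟨
      r (B ∪ fromList (elements ⊤)) ≤⟨ r-∪-fromList B basis-closed (elements ⊤) ⟩
      r B                           ∎)
      where open ≤-Reasoning

    basis-size : ∣ B ∣ ≡ rank
    basis-size = trans (sym (proj₁ B-basis)) basis-rank

    module _ (F : Subset m) where

      ∃-basisOver-of-basis : ∃[ T ] BasisOver F B T × ∣ B ∩ ∁ T ∣ ≡ r F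
      ∃-basisOver-of-basis with ∃-basisOver F (elements B)
      ... | T , T⊆B′ , indep , span = T , (T⊆B , indep , span′) , ∣B∩∁T∣≡rF
        where
        T⊆B : T ⊆ B
        T⊆B = subst (T ⊆_) (fromList-elements B) T⊆B′

        span′ : r (F ∪ B) ≤ r (F ∪ T)
        span′ = subst (λ p → r (F ∪ p) ≤ r (F ∪ T)) (fromList-elements B) span

        rank≤r[F∪T] : rank ≤ r (F ∪ T)
        rank≤r[F∪T] = ≤-trans (≤-reflexive (sym basis-rank)) (≤-trans (r-mono (q⊆p∪q F B)) span′)

        ∣B∩∁T∣≡rF : ∣ B ∩ ∁ T ∣ ≡ r F
        ∣B∩∁T∣≡rF = +-cancelˡ-≡ ∣ T ∣ ∣ B ∩ ∁ T ∣ (r F) (begin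
          ∣ T ∣ + ∣ B ∩ ∁ T ∣     ≡⟨ cong (λ p → ∣ p ∣ + ∣ B ∩ ∁ T ∣) (p⊆q⇒q∩p≡p T⊆B) ⟨
          ∣ B ∩ T ∣ + ∣ B ∩ ∁ T ∣ ≡⟨ ∣p∣≡∣p∩q∣+∣p∩∁q∣ B T ⟨
          ∣ B ∣                   ≡⟨ basis-size ⟩
          rank                    ≡⟨ ≤-antisym rank≤r[F∪T] (r-mono (⊆-max (F ∪ T))) ⟩
          r (F ∪ T)               ≡⟨ ≤-antisym (r[A∪C]≤r[A]+∣C∣ F T) indep ⟩
          r F + ∣ T ∣             ≡⟨ +-comm (r F) ∣ T ∣ ⟩
          ∣ T ∣ + r F             ∎)
          where open ≡-Reasoning

      -- X: any s elements of B ∖ T, for T a basis of B over F; what remains of B ∖ T has r F ∸ s elements.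
      basis-cover : ∀ {s} → s ≤ r F →
        ∃[ X ] ∣ B ∩ X ∣ ≡ s × ∣ B ∩ ∁ X ∣ ≡ rank ∸ s × (∀ S → S ⊆ B → s + ∣ S ∩ ∁ X ∣ ≤ r (F ∪ S))
      basis-cover {s} s≤rF with ∃-basisOver-of-basis
      ... | T , (T⊆B , indep , _) , ∣Z∣≡rF with ∃-⊆-of-size (B ∩ ∁ T) (subst (s ≤_) (sym ∣Z∣≡rF) s≤rF)
      ...   | X , X⊆Z , ∣X∣≡s = X , ∣B∩X∣≡s , ∣B∩∁X∣≡rank∸s , cover
        where
        Z : Subset m
        Z = B ∩ ∁ T

        X⊆B : X ⊆ B
        X⊆B = ⊆-trans X⊆Z (p∩q⊆p B (∁ T))

        ∣B∩X∣≡s : ∣ B ∩ X ∣ ≡ s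
        ∣B∩X∣≡s = trans (cong ∣_∣ (p⊆q⇒q∩p≡p X⊆B)) ∣X∣≡s

        ∣B∩∁X∣≡rank∸s : ∣ B ∩ ∁ X ∣ ≡ rank ∸ s
        ∣B∩∁X∣≡rank∸s = begin
          ∣ B ∩ ∁ X ∣                 ≡⟨ m+n∸m≡n s ∣ B ∩ ∁ X ∣ ⟨
          s + ∣ B ∩ ∁ X ∣ ∸ s         ≡⟨ cong (λ a → a + ∣ B ∩ ∁ X ∣ ∸ s) ∣B∩X∣≡s ⟨
          ∣ B ∩ X ∣ + ∣ B ∩ ∁ X ∣ ∸ s ≡⟨ cong (_∸ s) (∣p∣≡∣p∩q∣+∣p∩∁q∣ B X) ⟨
          ∣ B ∣ ∸ s                   ≡⟨ cong (_∸ s) basis-size ⟩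
          rank ∸ s                    ∎
          where open ≡-Reasoning

        s+∣Z∩∁X∣≡rF : s + ∣ Z ∩ ∁ X ∣ ≡ r F
        s+∣Z∩∁X∣≡rF = begin
          s + ∣ Z ∩ ∁ X ∣         ≡⟨ cong (λ a → a + ∣ Z ∩ ∁ X ∣) ∣X∣≡s ⟨
          ∣ X ∣ + ∣ Z ∩ ∁ X ∣     ≡⟨ cong (λ p → ∣ p ∣ + ∣ Z ∩ ∁ X ∣) (p⊆q⇒q∩p≡p X⊆Z) ⟨
          ∣ Z ∩ X ∣ + ∣ Z ∩ ∁ X ∣ ≡⟨ ∣p∣≡∣p∩q∣+∣p∩∁q∣ Z X ⟨
          ∣ Z ∣                   ≡⟨ ∣Z∣≡rF ⟩
          r F                     ∎
          where open ≡-Reasoning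

        cover : ∀ S → S ⊆ B → s + ∣ S ∩ ∁ X ∣ ≤ r (F ∪ S)
        cover S S⊆B = begin
          s + ∣ S ∩ ∁ X ∣                                 ≡⟨ cong (s +_) (∣p∣≡∣p∩q∣+∣p∩∁q∣ (S ∩ ∁ X) T) ⟩
          s + (∣ (S ∩ ∁ X) ∩ T ∣ + ∣ (S ∩ ∁ X) ∩ ∁ T ∣)
            ≤⟨ +-monoʳ-≤ s (+-mono-≤ (p⊆q⇒∣p∣≤∣q∣ in-T) (p⊆q⇒∣p∣≤∣q∣ in-Z∖X)) ⟩
          s + (∣ S ∩ T ∣ + ∣ Z ∩ ∁ X ∣)                   ≡⟨ x∙yz≈y∙xz s ∣ S ∩ T ∣ ∣ Z ∩ ∁ X ∣ ⟩
          ∣ S ∩ T ∣ + (s + ∣ Z ∩ ∁ X ∣)                   ≡⟨ cong (∣ S ∩ T ∣ +_) s+∣Z∩∁X∣≡rF ⟩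
          ∣ S ∩ T ∣ + r F                                 ≡⟨ +-comm ∣ S ∩ T ∣ (r F) ⟩
          r F + ∣ S ∩ T ∣                                 ≤⟨ r-independent-⊆ F (p∩q⊆q S T) indep ⟩
          r (F ∪ (S ∩ T))
            ≤⟨ r-mono (∪-least (p⊆p∪q S) (⊆-trans (p∩q⊆p S T) (q⊆p∪q F S))) ⟩
          r (F ∪ S)                                       ∎
          where
          open ≤-Reasoning
          in-T : (S ∩ ∁ X) ∩ T ⊆ S ∩ T
          in-T = ∩-greatest (⊆-trans (p∩q⊆p (S ∩ ∁ X) T) (p∩q⊆p S (∁ X))) (p∩q⊆q (S ∩ ∁ X) T)
          in-Z∖X : (S ∩ ∁ X) ∩ ∁ T ⊆ Z ∩ ∁ X
          in-Z∖X = ∩-greatest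
            (∩-greatest (⊆-trans (p∩q⊆p (S ∩ ∁ X) (∁ T)) (⊆-trans (p∩q⊆p S (∁ X)) S⊆B)) (p∩q⊆q (S ∩ ∁ X) (∁ T)))
            (⊆-trans (p∩q⊆p (S ∩ ∁ X) (∁ T)) (p∩q⊆q S (∁ X)))

  badMatroidFrom : ∀ {j} → ℕ → ℕ → Subset m → Vec (Subset m) j → ℕ
  badMatroidFrom k α F Bs = length (filter (λ Ss → r (F ∪ ⋃ (toList Ss)) <? k) (sample α Bs))

  badMatroidFrom≤freeCount : ∀ k α {j} (Bs : Vec (Subset m) j) → (∀ i → IsBasis (lookup Bs i)) →
    ∀ F {s} → s ≤ r F → badMatroidFrom k α F Bs ≤ freeCount rank k α s j
  badMatroidFrom≤freeCount k α [] _ F {s} s≤rF = begin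
    badMatroidFrom k α F []           ≡⟨ length-filter-singleton (λ Ss → r (F ∪ ⋃ (toList Ss)) <? k) [] ⟩
    (if r (F ∪ ⊥) <ᵇ k then 1 else 0) ≡⟨ cong (λ A → if r A <ᵇ k then 1 else 0) (∪-identityʳ F) ⟩
    (if r F <ᵇ k then 1 else 0)       ≤⟨ if-<ᵇ-antitone k s≤rF ⟩
    (if s <ᵇ k then 1 else 0)         ∎
    where open ≤-Reasoning
  badMatroidFrom≤freeCount k α {suc j} (B ∷ Bs) bases F {s} s≤rF with basis-cover (bases zero) F s≤rF
  ... | X , ∣B∩X∣≡s , ∣B∩∁X∣≡rank∸s , cover = begin
    badMatroidFrom k α F (B ∷ Bs)
      ≡⟨ length-filter-sample-∷ α B Bs (λ Ss → r (F ∪ ⋃ (toList Ss)) <? k) ⟩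
    ∑chosen α B (λ S → length (filter (λ Ss → r (F ∪ (S ∪ ⋃ (toList Ss))) <? k) (sample α Bs)))
      ≡⟨ ∑chosen-cong α B (λ S → length-filter-<-cong (sample α Bs) k
                                   (λ Ss → cong r (∪-assoc F S (⋃ (toList Ss))))) ⟨
    ∑chosen α B (λ S → badMatroidFrom k α (F ∪ S) Bs)
      ≤⟨ ∑chosen-mono α B (λ S S⊆B → badMatroidFrom≤freeCount k α Bs (bases ∘ suc) (F ∪ S) (cover S S⊆B)) ⟩
    ∑chosen α B (λ S → freeCount rank k α (s + ∣ S ∩ ∁ X ∣) j)
      ≡⟨ ∑chosen≡chooseSum m B X α (λ d → freeCount rank k α (s + d) j) ⟩
    chooseSum (∣ B ∩ ∁ X ∣) (∣ B ∩ X ∣) α (λ d → freeCount rank k α (s + d) j)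
      ≡⟨ cong₂ (λ p q → chooseSum p q α (λ d → freeCount rank k α (s + d) j)) ∣B∩∁X∣≡rank∸s ∣B∩X∣≡s ⟩
    freeCount rank k α s (suc j) ∎
    where open ≤-Reasoning

  badMatroid≤badFree : ∀ k α (Bs : Vec (Subset m) k) → (∀ i → IsBasis (lookup Bs i)) →
    badMatroid M k α Bs ≤ badFree rank k α
  badMatroid≤badFree k α Bs bases = begin
    badMatroid M k α Bs
      ≡⟨ length-filter-<-cong (sample α Bs) k (λ Ss → cong r (∪-identityˡ (⋃ (toList Ss)))) ⟨
    badMatroidFrom k α ⊥ Bs ≤⟨ badMatroidFrom≤freeCount k α Bs bases ⊥ z≤n ⟩
    freeCount rank k α 0 k  ≡⟨ badFree≡freeCount rank k α ⟨
    badFree rank k α        ∎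
    where open ≤-Reasoning

lookup-allFull : ∀ n k (i : Fin k) → lookup (allFull n k) i ≡ ⊤
lookup-allFull n (suc k) zero    = refl
lookup-allFull n (suc k) (suc i) = lookup-allFull n k i

lemma5 : (n k : ℕ) → .{{NonZero n}} → .{{NonZero k}} → k ≤ n →
         (c α : ℕ) → IsCeilLog n c → α ≡ 3 * c → α ≤ n →
         (m : ℕ) (M : Matroid m) → Matroid.rank M ≡ n →
         (Bs : Vec (Subset m) k) → (∀ i → Matroid.IsBasis M (lookup Bs i)) →
         -- Q(B₁,…,B_k) ≤ Q_{k,n}, with probabilities as (favourable / total)
         badMatroid M k α Bs * totalFree n k α ≤ badFree n k α * totalMatroid α Bs
lemma5 n k _ _ α _ _ _ m M refl Bs bases =
  subst₂ (λ x y → badMatroid M k α Bs * x ≤ badFree n k α * y) (sym totalFree≡) (sym totalMatroid≡)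
         (*-monoˡ-≤ ((n C α) ^ k) (badMatroid≤badFree M k α Bs bases))
  where
  totalFree≡ : totalFree n k α ≡ (n C α) ^ k
  totalFree≡ = length-sample α n (allFull n k) (λ i → trans (cong ∣_∣ (lookup-allFull n k i)) (∣⊤∣≡n n))
  totalMatroid≡ : totalMatroid α Bs ≡ (n C α) ^ k
  totalMatroid≡ = length-sample α n Bs (λ i → basis-size M (bases i))
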